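{- Let $A,B$ be finite groups, $G$ a subgroup of $A\times B$, and $\pi_A,\pi_B$ the projections onto $A$ and $B$. Then $[A\times B:G]$ divides $[A:\pi_A(G)]\cdot[B:\pi_B(G)]\cdot\gcd(|\pi_A(G)|,|\pi_B(G)|)$. -}

module Defs where

open import Level using (0ℓ)
open import Data.Nat using (ℕ; zero; suc; _*_)
open import Data.Nat.DivMod using (_/_)
open import Data.Fin using (Fin)
open import Data.Fin.Properties using (any?)
open import Data.List using (List; length; filter; cartesianProduct)
open import Data.Fin.Base using ()
open import Data.List using ()
open import Data.Product using (_×_; _,_; ∃)
open import Relation.Nullary using (Dec)
open import Relation.Unary using (Pred; Decidable)
open import Relation.Binary.PropositionalEquality using (_≡_)
open import Algebra.Structures using (IsGroup)
import Data.List.Base as L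

-- A finite group of order n, presented on the carrier Fin n
-- (every finite group is isomorphic to such a one).
record FinGroup (n : ℕ) : Set where
  field
    _∙_     : Fin n → Fin n → Fin n
    ε       : Fin n
    _⁻¹     : Fin n → Fin n
    isGroup : IsGroup _≡_ _∙_ ε _⁻¹

elems : (n : ℕ) → List (Fin n)
elems n = L.allFin n

record SubgroupProd {a b : ℕ} (A : FinGroup a) (B : FinGroup b) : Set₁ where
  open FinGroup A renaming (_∙_ to _∙A_; ε to εA; _⁻¹ to invA)
  open FinGroup B renaming (_∙_ to _∙B_; ε to εB; _⁻¹ to invB)
  field
    Mem   : Pred (Fin a × Fin b) 0ℓ
    Mem?  : Decidable Mem
    ε-mem : Mem (εA , εB)
    ∙-mem : ∀ {x y x′ y′} → Mem (x , y) → Mem (x′ , y′) → Mem (x ∙A x′ , y ∙B y′)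
    ⁻¹-mem : ∀ {x y} → Mem (x , y) → Mem (invA x , invB y)

module _ {a b : ℕ} {A : FinGroup a} {B : FinGroup b} (G : SubgroupProd A B) where
  open SubgroupProd G

  orderG : ℕ
  orderG = length (filter Mem? (cartesianProduct (elems a) (elems b)))

  πA : Pred (Fin a) 0ℓ
  πA x = ∃ λ (y : Fin b) → Mem (x , y)

  πB : Pred (Fin b) 0ℓ
  πB y = ∃ λ (x : Fin a) → Mem (x , y)

  πA? : Decidable πA
  πA? x = any? (λ y → Mem? (x , y))

  πB? : Decidable πB
  πB? y = any? (λ x → Mem? (x , y))

  orderπA : ℕ
  orderπA = length (filter πA? (elems a))

  orderπB : ℕ
  orderπB = length (filter πB? (elems b))

-- index [K : H] = |K| / |H| (for finite groups); the zero case never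
-- occurs for subgroups (they contain the identity) and is a dummy.
index : (orderK orderH : ℕ) → ℕ
index k zero    = 0
index k (suc h) = k / suc h

-- Write N_A = G ∩ (A × 1) and N_B = G ∩ (1 × B), viewed as subgroups of A and B.  Every
-- fibre of G over π_A(G) is a coset of N_B, so |G| = |π_A(G)| |N_B|, and symmetrically
-- |G| = |π_B(G)| |N_A|.  Since N_B ≤ π_B(G), the number m = |π_B(G)| / |N_B| = |π_A(G)| / |N_A|
-- is an integer dividing both |π_A(G)| and |π_B(G)|, hence their gcd, and
-- [A × B : G] = [A : π_A(G)] [B : π_B(G)] m.  All divisibilities are Lagrange's theorem in
-- the form: a set closed under right multiplication by a subgroup H is a disjoint union of
-- left cosets of H, so |H| divides its size.
module Submission where

open import Defs
open import Level using (Level; 0ℓ)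
open import Algebra.Bundles using (Group)
import Algebra.Properties.Group as GroupProperties
open import Algebra.Structures using (IsGroup)
open import Data.Bool using (if_then_else_)
open import Data.Empty using (⊥-elim)
open import Data.Fin using (Fin; zero; suc)
open import Data.Fin.Permutation using (Permutation; permutation)
open import Data.Fin.Properties using (any?)
open import Data.List using (List; []; _∷_; _++_; map; tabulate; allFin; length; filter; cartesianProduct)
open import Data.List.Properties using (map-++; map-∘; map-tabulate)
open import Data.Nat using (ℕ; zero; suc; _+_; _*_; _≤_; NonZero; >-nonZero⁻¹)
open import Data.Nat.Properties
open import Algebra.Properties.Semiring.Sum +-*-semiring
  using (sum; sum-cong-≗; ∑-comm; ∑-permute; ∑-distrib-+; *-distribʳ-sum)
open import Data.Nat.Divisibility using (_∣_; divides; ∣-refl; _∣0; m∣m*n; ∣m∣n⇒∣m+n; *-monoʳ-∣)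
open import Data.Nat.DivMod using (m*n/n≡m)
open import Data.Nat.GCD using (gcd; gcd-greatest)
open import Data.Nat.ListAction using () renaming (sum to lsum)
open import Data.Nat.ListAction.Properties using (sum-++)
open import Data.Nat.Tactic.RingSolver using (solve-∀)
open import Data.Product using (_×_; _,_; swap)
open import Function using (id)
open import Relation.Nullary using (yes; no; does)
open import Relation.Unary using (Pred; Decidable; Empty; ∁; _∩_; _⊆_)
open import Relation.Unary.Properties using (U?; ∁?; _∩?_)
open import Relation.Binary.PropositionalEquality

private variable
  ℓ ℓ′ : Level
  A B : Set
  n : ℕ

indicator : {P : Pred A ℓ} → Decidable P → A → ℕ
indicator P? x = if does (P? x) then 1 else 0

count : {P : Pred (Fin n) ℓ} → Decidable P → ℕ
count P? = sum (indicator P?)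

length-filter≡lsum-indicator : {P : Pred A ℓ} (P? : Decidable P) (xs : List A) →
                               length (filter P? xs) ≡ lsum (map (indicator P?) xs)
length-filter≡lsum-indicator P? []       = refl
length-filter≡lsum-indicator P? (x ∷ xs) with P? x
... | yes _ = cong suc (length-filter≡lsum-indicator P? xs)
... | no  _ = length-filter≡lsum-indicator P? xs

lsum-tabulate : (f : Fin n → ℕ) → lsum (tabulate f) ≡ sum f
lsum-tabulate {zero}  f = refl
lsum-tabulate {suc n} f = cong (f zero +_) (lsum-tabulate (λ i → f (suc i)))

lsum-map-allFin : (f : Fin n → ℕ) → lsum (map f (allFin n)) ≡ sum f
lsum-map-allFin f = trans (cong lsum (map-tabulate id f)) (lsum-tabulate f)

lsum-map-cartesianProduct : (f : A × B → ℕ) (xs : List A) (ys : List B) →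
  lsum (map f (cartesianProduct xs ys)) ≡ lsum (map (λ x → lsum (map (λ y → f (x , y)) ys)) xs)
lsum-map-cartesianProduct f []       ys = refl
lsum-map-cartesianProduct f (x ∷ xs) ys = begin
  lsum (map f (map (x ,_) ys ++ cartesianProduct xs ys))
    ≡⟨ cong lsum (map-++ f (map (x ,_) ys) _) ⟩
  lsum (map f (map (x ,_) ys) ++ map f (cartesianProduct xs ys))
    ≡⟨ sum-++ (map f (map (x ,_) ys)) _ ⟩
  lsum (map f (map (x ,_) ys)) + lsum (map f (cartesianProduct xs ys))
    ≡⟨ cong₂ _+_ (cong lsum (sym (map-∘ ys))) (lsum-map-cartesianProduct f xs ys) ⟩
  lsum (map (λ y → f (x , y)) ys) + lsum (map (λ x → lsum (map (λ y → f (x , y)) ys)) xs) ∎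
  where open ≡-Reasoning

length-filter-allFin : {P : Pred (Fin n) ℓ} (P? : Decidable P) →
                       length (filter P? (allFin n)) ≡ count P?
length-filter-allFin P? =
  trans (length-filter≡lsum-indicator P? (allFin _)) (lsum-map-allFin (indicator P?))

length-filter-allFin² : {m : ℕ} {P : Pred (Fin m × Fin n) ℓ} (P? : Decidable P) →
  length (filter P? (cartesianProduct (allFin m) (allFin n))) ≡ sum (λ x → count (λ y → P? (x , y)))
length-filter-allFin² {n} {m = m} P? = begin
  length (filter P? (cartesianProduct (allFin m) (allFin n)))
    ≡⟨ length-filter≡lsum-indicator P? (cartesianProduct (allFin m) (allFin n)) ⟩
  lsum (map (indicator P?) (cartesianProduct (allFin m) (allFin n)))
    ≡⟨ lsum-map-cartesianProduct (indicator P?) (allFin m) (allFin n) ⟩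
  lsum (map (λ x → lsum (map (λ y → indicator P? (x , y)) (allFin n))) (allFin m))
    ≡⟨ lsum-map-allFin (λ x → lsum (map (λ y → indicator P? (x , y)) (allFin n))) ⟩
  sum (λ x → lsum (map (λ y → indicator P? (x , y)) (allFin n)))
    ≡⟨ sum-cong-≗ (λ x → lsum-map-allFin (λ y → indicator P? (x , y))) ⟩
  sum (λ x → count (λ y → P? (x , y))) ∎
  where open ≡-Reasoning

count-U : count {n} U? ≡ n
count-U {zero}  = refl
count-U {suc n} = cong suc (count-U {n})

count-empty : {P : Pred (Fin n) ℓ} (P? : Decidable P) → Empty P → count P? ≡ 0
count-empty {zero}  P? P-empty = refl
count-empty {suc n} P? P-empty with P? zero
... | yes P0 = ⊥-elim (P-empty zero P0)
... | no  _  = count-empty (λ i → P? (suc i)) (λ i → P-empty (suc i))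

count-nonZero : {P : Pred (Fin n) ℓ} (P? : Decidable P) {x : Fin n} → P x → NonZero (count P?)
count-nonZero P? {zero} Px with P? zero
... | yes _   = _
... | no ¬P0 = ⊥-elim (¬P0 Px)
count-nonZero P? {suc x} Px with P? zero
... | yes _ = _
... | no  _ = count-nonZero (λ i → P? (suc i)) Px

count-cong : {P : Pred (Fin n) ℓ} {Q : Pred (Fin n) ℓ′} (P? : Decidable P) (Q? : Decidable Q) →
             P ⊆ Q → Q ⊆ P → count P? ≡ count Q?
count-cong P? Q? P⊆Q Q⊆P = sum-cong-≗ pointwise
  where
  pointwise : ∀ i → indicator P? i ≡ indicator Q? i
  pointwise i with P? i | Q? i
  ... | yes _  | yes _  = refl
  ... | no _   | no _   = refl
  ... | yes Pi | no ¬Qi = ⊥-elim (¬Qi (P⊆Q Pi))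
  ... | no ¬Pi | yes Qi = ⊥-elim (¬Pi (Q⊆P Qi))

count-split : {P : Pred (Fin n) ℓ} {Q : Pred (Fin n) ℓ′} (P? : Decidable P) (Q? : Decidable Q) →
              Q ⊆ P → count P? ≡ count Q? + count (P? ∩? ∁? Q?)
count-split P? Q? Q⊆P =
  trans (sum-cong-≗ pointwise) (∑-distrib-+ (indicator Q?) (indicator (P? ∩? ∁? Q?)))
  where
  pointwise : ∀ i → indicator P? i ≡ indicator Q? i + indicator (P? ∩? ∁? Q?) i
  pointwise i with P? i | Q? i
  ... | yes _  | yes _  = refl
  ... | yes _  | no _   = refl
  ... | no _   | no _   = refl
  ... | no ¬Pi | yes Qi = ⊥-elim (¬Pi (Q⊆P Qi))

-- Lagrange's theorem

toGroup : FinGroup n → Group 0ℓ 0ℓ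
toGroup 𝔾 = record { isGroup = FinGroup.isGroup 𝔾 }

module _ (𝔾 : FinGroup n) where
  open FinGroup 𝔾
  open IsGroup isGroup using (assoc)
  open GroupProperties (toGroup 𝔾) using (\\-leftDividesˡ; \\-leftDividesʳ; //-rightDividesʳ)

  count-translate : {P : Pred (Fin n) ℓ} (P? : Decidable P) (x : Fin n) →
                    count (λ y → P? (x ∙ y)) ≡ count P?
  count-translate P? x = sym (∑-permute (indicator P?) left-translation)
    where
    left-translation : Permutation n n
    left-translation = permutation (x ∙_) ((x ⁻¹) ∙_) (\\-leftDividesˡ x) (\\-leftDividesʳ x)

  record IsSubgroup (H : Pred (Fin n) ℓ) : Set ℓ where
    field
      ε∈  : H ε
      ∙∈  : ∀ {x y} → H x → H y → H (x ∙ y)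
      ⁻¹∈ : ∀ {x} → H x → H (x ⁻¹)

  IsUnionOfCosets : Pred (Fin n) ℓ → Pred (Fin n) ℓ′ → Set _
  IsUnionOfCosets H S = ∀ {y h} → S y → H h → S (y ∙ h)

  module _ {H : Pred (Fin n) ℓ} (H? : Decidable H) (H-subgroup : IsSubgroup H) where
    open IsSubgroup H-subgroup

    coset : Fin n → Pred (Fin n) ℓ
    coset x y = H ((x ⁻¹) ∙ y)

    coset? : (x : Fin n) → Decidable (coset x)
    coset? x y = H? ((x ⁻¹) ∙ y)

    module _ {S : Pred (Fin n) ℓ′} (S? : Decidable S) (S-cosets : IsUnionOfCosets H S)
             {x : Fin n} (Sx : S x) where

      coset⊆ : coset x ⊆ S
      coset⊆ {y} xH∋y = subst S (\\-leftDividesˡ x y) (S-cosets Sx xH∋y)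

      count-remove-coset : count S? ≡ count H? + count (S? ∩? ∁? (coset? x))
      count-remove-coset = trans (count-split S? (coset? x) coset⊆)
                                 (cong (_+ count (S? ∩? ∁? (coset? x))) (count-translate H? (x ⁻¹)))

      remove-coset-isUnionOfCosets : IsUnionOfCosets H (S ∩ ∁ (coset x))
      remove-coset-isUnionOfCosets {y} {h} (Sy , y∉xH) Hh =
        S-cosets Sy Hh , λ yh∈xH → y∉xH (subst H (x⁻¹yh·h⁻¹≡x⁻¹y) (∙∈ yh∈xH (⁻¹∈ Hh)))
        where
        x⁻¹yh·h⁻¹≡x⁻¹y : ((x ⁻¹) ∙ (y ∙ h)) ∙ (h ⁻¹) ≡ (x ⁻¹) ∙ y
        x⁻¹yh·h⁻¹≡x⁻¹y = trans (cong (_∙ (h ⁻¹)) (sym (assoc (x ⁻¹) y h)))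
                               (//-rightDividesʳ h ((x ⁻¹) ∙ y))

    count-subgroup-∣ : {S : Pred (Fin n) ℓ′} (S? : Decidable S) →
                       IsUnionOfCosets H S → count H? ∣ count S?
    count-subgroup-∣ S? S-cosets = peel (count S?) S? S-cosets ≤-refl
      where
      instance
        H-nonZero : NonZero (count H?)
        H-nonZero = count-nonZero H? ε∈

      peel : ∀ fuel {S : Pred (Fin n) ℓ′} (S? : Decidable S) →
             IsUnionOfCosets H S → count S? ≤ fuel → count H? ∣ count S?
      peel zero S? _ S≤0 = subst (count H? ∣_) (sym (n≤0⇒n≡0 S≤0)) (count H? ∣0)
      peel (suc fuel) S? S-cosets S≤fuel with any? S?
      ... | no ∄S = subst (count H? ∣_) (sym (count-empty S? (λ x Sx → ∄S (x , Sx)))) (count H? ∣0)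
      ... | yes (x , Sx) =
        subst (count H? ∣_) (sym remove)
          (∣m∣n⇒∣m+n ∣-refl (peel fuel (S? ∩? ∁? (coset? x))
                                   (remove-coset-isUnionOfCosets S? S-cosets Sx) rest≤fuel))
        where
        remove : count S? ≡ count H? + count (S? ∩? ∁? (coset? x))
        remove = count-remove-coset S? S-cosets Sx
        rest≤fuel : count (S? ∩? ∁? (coset? x)) ≤ fuel
        rest≤fuel = ≤-pred (≤-trans (≤-trans (m<n+m _ (>-nonZero⁻¹ (count H?)))
                                             (≤-reflexive (sym remove)))
                                    S≤fuel)

index-*ˡ : ∀ c h .{{_ : NonZero h}} → index (c * h) h ≡ c
index-*ˡ c (suc h) = m*n/n≡m c (suc h)

index-*-∣-gcd : ∀ {a b p q k l} .{{_ : NonZero p}} .{{_ : NonZero q}} .{{_ : NonZero l}} →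
                p ∣ a → q ∣ b → l ∣ q → p * l ≡ q * k →
                index (a * b) (p * l) ∣ index a p * index b q * gcd p q
index-*-∣-gcd {p = p} {k = k} {l = l} (divides a′ refl) (divides b′ refl) (divides m refl) pl≡mlk =
  subst₂ _∣_ (sym index[ab,pl])
    (cong₂ (λ i j → i * j * gcd p (m * l)) (sym (index-*ˡ a′ p)) (sym (index-*ˡ b′ (m * l))))
    (*-monoʳ-∣ (a′ * b′) m∣gcd)
  where
  instance
    pl-nonZero : NonZero (p * l)
    pl-nonZero = m*n≢0 p l

  p≡m*k : p ≡ m * k
  p≡m*k = *-cancelʳ-≡ p (m * k) l (trans pl≡mlk (*-right-comm m l k))
    where
    *-right-comm : ∀ x y z → x * y * z ≡ x * z * y
    *-right-comm = solve-∀

  m∣gcd : m ∣ gcd p (m * l)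
  m∣gcd = gcd-greatest (divides k (trans p≡m*k (*-comm m k))) (m∣m*n l)

  index[ab,pl] : index (a′ * p * (b′ * (m * l))) (p * l) ≡ a′ * b′ * m
  index[ab,pl] = trans (cong (λ t → index t (p * l)) (rearrange a′ p b′ m l))
                       (index-*ˡ (a′ * b′ * m) (p * l))
    where
    rearrange : ∀ x y z u v → x * y * (z * (u * v)) ≡ x * z * u * (y * v)
    rearrange = solve-∀

-- Subgroups of a direct product

swapSubgroup : {a b : ℕ} {A : FinGroup a} {B : FinGroup b} → SubgroupProd A B → SubgroupProd B A
swapSubgroup G = record
  { Mem    = λ yx → Mem (swap yx)
  ; Mem?   = λ yx → Mem? (swap yx)
  ; ε-mem  = ε-mem
  ; ∙-mem  = ∙-mem
  ; ⁻¹-mem = ⁻¹-mem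
  }
  where open SubgroupProd G

orderG-swap : {a b : ℕ} {A : FinGroup a} {B : FinGroup b} (G : SubgroupProd A B) →
              orderG (swapSubgroup G) ≡ orderG G
orderG-swap G = begin
  orderG (swapSubgroup G)                          ≡⟨ length-filter-allFin² (λ yx → Mem? (swap yx)) ⟩
  sum (λ y → sum (λ x → indicator Mem? (x , y)))   ≡⟨ ∑-comm (λ y x → indicator Mem? (x , y)) ⟩
  sum (λ x → sum (λ y → indicator Mem? (x , y)))   ≡⟨ length-filter-allFin² Mem? ⟨
  orderG G                                         ∎
  where
  open SubgroupProd G
  open ≡-Reasoning

module _ {a b : ℕ} {A : FinGroup a} {B : FinGroup b} (G : SubgroupProd A B) where
  open SubgroupProd G
  open FinGroup A using () renaming (ε to εA; isGroup to isGroupA)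
  open FinGroup B using () renaming (_∙_ to _∙B_; ε to εB)
  open IsGroup isGroupA using () renaming (identityʳ to identityʳA; inverseˡ to inverseˡA)
  open GroupProperties (toGroup A) using () renaming (ε⁻¹≈ε to ε⁻¹≈εA)
  open GroupProperties (toGroup B) using () renaming (\\-leftDividesʳ to \\-leftDividesʳB)

  -- N_B = ker(π_A ∣ G), viewed as a subset of B; N_A is kerπA of swapSubgroup G.
  kerπA : Pred (Fin b) 0ℓ
  kerπA y = Mem (εA , y)

  kerπA? : Decidable kerπA
  kerπA? y = Mem? (εA , y)

  πA-isSubgroup : IsSubgroup A (πA G)
  πA-isSubgroup = record
    { ε∈  = εB , ε-mem
    ; ∙∈  = λ (_ , m) (_ , m′) → _ , ∙-mem m m′
    ; ⁻¹∈ = λ (_ , m) → _ , ⁻¹-mem m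
    }

  kerπA-isSubgroup : IsSubgroup B kerπA
  kerπA-isSubgroup = record
    { ε∈  = ε-mem
    ; ∙∈  = λ m m′ → subst (λ x → Mem (x , _)) (identityʳA εA) (∙-mem m m′)
    ; ⁻¹∈ = λ m → subst (λ x → Mem (x , _)) ε⁻¹≈εA (⁻¹-mem m)
    }

  πB-isUnionOfCosets : IsUnionOfCosets B kerπA (πB G)
  πB-isUnionOfCosets (x , m) m′ = x , subst (λ x → Mem (x , _)) (identityʳA x) (∙-mem m m′)

  orderπA-nonZero : NonZero (orderπA G)
  orderπA-nonZero = subst NonZero (sym (length-filter-allFin (πA? G))) (count-nonZero (πA? G) (εB , ε-mem))

  count-kerπA-nonZero : NonZero (count kerπA?)
  count-kerπA-nonZero = count-nonZero kerπA? ε-mem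

  orderπA∣order : orderπA G ∣ a
  orderπA∣order = subst₂ _∣_ (sym (length-filter-allFin (πA? G))) count-U
    (count-subgroup-∣ A (πA? G) πA-isSubgroup U? (λ _ _ → _))

  count-kerπA∣orderπB : count kerπA? ∣ orderπB G
  count-kerπA∣orderπB = subst (count kerπA? ∣_) (sym (length-filter-allFin (πB? G)))
    (count-subgroup-∣ B kerπA? kerπA-isSubgroup (πB? G) πB-isUnionOfCosets)

  count-fibre : ∀ x → count (λ y → Mem? (x , y)) ≡ indicator (πA? G) x * count kerπA?
  count-fibre x with πA? G x
  ... | no x∉πA = count-empty (λ y → Mem? (x , y)) (λ y m → x∉πA (y , m))
  ... | yes (y₀ , m₀) = begin
    count (λ y → Mem? (x , y))          ≡⟨ count-translate B (λ y → Mem? (x , y)) y₀ ⟨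
    count (λ y → Mem? (x , y₀ ∙B y))    ≡⟨ count-cong (λ y → Mem? (x , y₀ ∙B y)) kerπA? to from ⟩
    count kerπA?                        ≡⟨ +-identityʳ (count kerπA?) ⟨
    1 * count kerπA?                    ∎
    where
    open ≡-Reasoning
    to : ∀ {y} → Mem (x , y₀ ∙B y) → kerπA y
    to {y} m = subst₂ (λ u v → Mem (u , v)) (inverseˡA x) (\\-leftDividesʳB y₀ y) (∙-mem (⁻¹-mem m₀) m)
    from : ∀ {y} → kerπA y → Mem (x , y₀ ∙B y)
    from m = subst (λ u → Mem (u , _)) (identityʳA x) (∙-mem m₀ m)

  orderG≡orderπA*count-kerπA : orderG G ≡ orderπA G * count kerπA?
  orderG≡orderπA*count-kerπA = begin
    orderG G                                          ≡⟨ length-filter-allFin² Mem? ⟩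
    sum (λ x → count (λ y → Mem? (x , y)))            ≡⟨ sum-cong-≗ count-fibre ⟩
    sum (λ x → indicator (πA? G) x * count kerπA?)    ≡⟨ *-distribʳ-sum (count kerπA?) (indicator (πA? G)) ⟨
    count (πA? G) * count kerπA?                      ≡⟨ cong (_* count kerπA?) (length-filter-allFin (πA? G)) ⟨
    orderπA G * count kerπA?                          ∎
    where open ≡-Reasoning

lemma6p4 : {a b : ℕ} (A : FinGroup a) (B : FinGroup b) (G : SubgroupProd A B) →
           index (a * b) (orderG G) ∣ index a (orderπA G) * index b (orderπB G) * gcd (orderπA G) (orderπB G)
lemma6p4 {a} {b} A B G =
  subst (λ g → index (a * b) g ∣ index a p * index b q * gcd p q) (sym (orderG≡orderπA*count-kerπA G))
    (index-*-∣-gcd {{orderπA-nonZero G}} {{orderπA-nonZero Gᵀ}} {{count-kerπA-nonZero G}}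
       (orderπA∣order G) (orderπA∣order Gᵀ) (count-kerπA∣orderπB G) p*l≡q*k)
  where
  Gᵀ : SubgroupProd B A
  Gᵀ = swapSubgroup G
  p q l k : ℕ
  p = orderπA G
  q = orderπB G
  l = count (kerπA? G)
  k = count (kerπA? Gᵀ)

  p*l≡q*k : p * l ≡ q * k
  p*l≡q*k = begin
    p * l      ≡⟨ orderG≡orderπA*count-kerπA G ⟨
    orderG G   ≡⟨ orderG-swap G ⟨
    orderG Gᵀ  ≡⟨ orderG≡orderπA*count-kerπA Gᵀ ⟩
    q * k      ∎
    where open ≡-Reasoning
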